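{- For any graph $G=(V,E)$, any coloring $\mathrm{col}$ of $G$, and any pivot $p\in V$, $\mathrm{OPT}_{\mathrm{Fixed}}(G,\mathrm{col},p)=\mathrm{OPT}_{\mathrm{S\text{ - }Fixed}}(G,\mathrm{col},p)$.
   Context: For a graph $G=(V,E)$ and a coloring $\mathrm{col}\colon V\to[c_{\max}]$, $\mathrm{Comp}(\mathrm{col},u)$ denotes the monochromatic connected component containing $u$. A move is a pair $(u,c)$ with $u\in V$ and $c\in[c_{\max}]$; its result recolors every vertex of $\mathrm{Comp}(\mathrm{col},u)$ with $c$. $\mathrm{OPT}_{\mathrm{Fixed}}(G,\mathrm{col},p)$ is the minimum number of moves, all of the form $(p,c)$, applied successively, whose result is a constant coloring. A set-move (with respect to pivot $p$) is a pair $(S,c)$ where either $S=\mathrm{Comp}(\mathrm{col},u)$ for some $u\in V$, or $\{p\}\subseteq S\subseteq\mathrm{Comp}(\mathrm{col},p)$; its result is the coloring that sets every vertex of $S$ to $c$ and leaves other vertices unchanged. $\mathrm{OPT}_{\mathrm{S\text{ - }Fixed}}(G,\mathrm{col},p)$ is the minimum number of set-moves, each of which satisfies $p\in S$, applied successively, whose result is a constant coloring. -}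

module Defs where

open import Data.Nat using (ℕ; zero; suc; _≤_)
open import Data.Fin using (Fin)
open import Data.Bool using (Bool; true; false)
open import Data.Fin.Subset using (Subset; _∈_; _∉_)
open import Data.Product using (Σ; ∃; _×_; _,_)
open import Data.Sum using (_⊎_)
open import Relation.Nullary using (¬_)
open import Relation.Binary.PropositionalEquality using (_≡_)

record Graph (n : ℕ) : Set where
  field
    adj    : Fin n → Fin n → Bool
    sym    : ∀ u v → adj u v ≡ adj v u
    irrefl : ∀ u → adj u u ≡ false

open Graph public

Coloring : ℕ → ℕ → Set
Coloring n cmax = Fin n → Fin cmax

module _ {n cmax : ℕ} (G : Graph n) where

  data MonoPath (col : Coloring n cmax) (u : Fin n) : Fin n → Set where
    here : MonoPath col u u
    step : ∀ {v w} → MonoPath col u v → adj G v w ≡ true →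
           col w ≡ col u → MonoPath col u w

  InComp : Coloring n cmax → Fin n → Fin n → Set
  InComp col u v = MonoPath col u v

  IsConstant : Coloring n cmax → Set
  IsConstant col = ∃ λ (c : Fin cmax) → ∀ v → col v ≡ c

  MoveResult : Coloring n cmax → Fin n → Fin cmax → Coloring n cmax → Set
  MoveResult col u c col' =
    ∀ v → (InComp col u v → col' v ≡ c) × (¬ InComp col u v → col' v ≡ col v)

  SetResult : Coloring n cmax → Subset n → Fin cmax → Coloring n cmax → Set
  SetResult col S c col' =
    ∀ v → (v ∈ S → col' v ≡ c) × (v ∉ S → col' v ≡ col v)

  IsSetMove : Coloring n cmax → Fin n → Subset n → Set
  IsSetMove col p S =
    (∃ λ u → ∀ v → (v ∈ S → InComp col u v) × (InComp col u v → v ∈ S))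
    ⊎ (p ∈ S × (∀ v → v ∈ S → InComp col p v))

  data FixedSeq (p : Fin n) : ℕ → Coloring n cmax → Set where
    done : ∀ {col} → IsConstant col → FixedSeq p zero col
    move : ∀ {k col} (c : Fin cmax) (col' : Coloring n cmax) →
           MoveResult col p c col' → FixedSeq p k col' →
           FixedSeq p (suc k) col

  data SFixedSeq (p : Fin n) : ℕ → Coloring n cmax → Set where
    done : ∀ {col} → IsConstant col → SFixedSeq p zero col
    move : ∀ {k col} (S : Subset n) (c : Fin cmax) (col' : Coloring n cmax) →
           IsSetMove col p S → p ∈ S → SetResult col S c col' →
           SFixedSeq p k col' → SFixedSeq p (suc k) col

  OptFixed≤ : Coloring n cmax → Fin n → ℕ → Set
  OptFixed≤ col p k = ∃ λ m → m ≤ k × FixedSeq p m col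

  OptSFixed≤ : Coloring n cmax → Fin n → ℕ → Set
  OptSFixed≤ col p k = ∃ λ m → m ≤ k × SFixedSeq p m col

module Submission where

-- Fixed ⇒ S-Fixed: the move (p , c) is the set-move (Comp(col,p) , c), so a
-- Fixed sequence is an S-Fixed sequence of the same length.
--
-- S-Fixed ⇒ Fixed: a set-move containing p recolours a subset of Comp(col,p).
-- We replay an S-Fixed sequence S₀ = col, S₁, … by the Fixed moves (p , cᵢ)
-- with the same colours, giving F₀ = col, F₁, …, and show that the relation
-- "F simulates S" (every vertex is in the pivot component of F or has the same
-- colour in F and S, F and S agree on p, and the pivot component of S lies in
-- that of F) holds initially, is preserved by each step, and transfers
-- constancy from S to F.
--
-- The Fixed move must be given as an explicit colouring, which needs
-- decidability of membership in Comp(col,p); this is proved first, for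
-- reachability by walks inside an arbitrary vertex subset.

open import Defs hiding (sym)
open Defs.Graph using () renaming (sym to adj-sym)
open import Data.Nat using (ℕ; zero; suc; _≤_)
open import Data.Nat.Properties using (<-≤-trans; <⇒≤pred)
open import Data.Fin using (Fin; _≟_)
open import Data.Fin.Properties using (any?)
open import Data.Fin.Subset using (Subset; _∈_; _⊆_; _-_; ⁅_⁆; ∣_∣)
open import Data.Fin.Subset.Properties
  using (_∈?_; ∣p∣≤n; x∈p⇒∣p-x∣<∣p∣; p─q⊆p; x∈p∧x≢y⇒x∈p-y)
open import Data.Vec using (tabulate)
open import Data.Vec.Properties using (lookup⇒[]=; []=⇒lookup; lookup∘tabulate)
open import Data.Bool using (true)
import Data.Bool as Bool
open import Data.Product using (_×_; _,_; proj₁; proj₂; ∃)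
open import Data.Sum using (_⊎_; inj₁; inj₂; [_,_])
open import Data.Empty using (⊥-elim)
open import Relation.Nullary using (¬_; Dec; yes; no; does)
open import Relation.Nullary.Decidable using (map′; dec-true)
open import Relation.Binary.PropositionalEquality using (_≡_; refl; sym; trans)

module _ {n : ℕ} {P : Fin n → Set} (P? : ∀ v → Dec (P v)) where

  subsetOf : Subset n
  subsetOf = tabulate (λ v → does (P? v))

  ∈-subsetOf⁺ : ∀ {v} → P v → v ∈ subsetOf
  ∈-subsetOf⁺ {v} pv =
    lookup⇒[]= v subsetOf (trans (lookup∘tabulate _ v) (dec-true (P? v) pv))

  ∈-subsetOf⁻ : ∀ {v} → v ∈ subsetOf → P v
  ∈-subsetOf⁻ {v} v∈ = witness (P? v) (trans (sym (lookup∘tabulate _ v)) ([]=⇒lookup v∈))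
    where
    witness : (d : Dec (P v)) → does d ≡ true → P v
    witness (yes pv) _ = pv
    witness (no _)  ()

module _ {n : ℕ} (G : Graph n) where

  data WalkIn (A : Subset n) (u : Fin n) : Fin n → Set where
    nil  : WalkIn A u u
    snoc : ∀ {v w} → WalkIn A u v → adj G v w ≡ true → w ∈ A → WalkIn A u w

  prepend : ∀ {A A' u w v} → A' ⊆ A → adj G u w ≡ true → w ∈ A →
            WalkIn A' w v → WalkIn A u v
  prepend A'⊆A uw w∈A nil              = snoc nil uw w∈A
  prepend A'⊆A uw w∈A (snoc q xy y∈A') = snoc (prepend A'⊆A uw w∈A q) xy (A'⊆A y∈A')

  -- A walk in A from u either is trivial or leaves u along an edge to some
  -- w ∈ A - u and then continues inside A - u (cut at the last visit to u).
  FirstStepVia : Subset n → Fin n → Fin n → Fin n → Set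
  FirstStepVia A u w v = adj G u w ≡ true × w ∈ A - u × WalkIn (A - u) w v

  FirstStep : Subset n → Fin n → Fin n → Set
  FirstStep A u v = ∃ λ w → FirstStepVia A u w v

  firstStep : ∀ {A u v} → WalkIn A u v → u ≡ v ⊎ FirstStep A u v
  firstStep nil = inj₁ refl
  firstStep {u = u} (snoc {w = y} q xy y∈A) with y ≟ u | firstStep q
  ... | yes y≡u | _                            = inj₁ (sym y≡u)
  ... | no y≢u  | inj₁ refl                    = inj₂ (y , xy , x∈p∧x≢y⇒x∈p-y y∈A y≢u , nil)
  ... | no y≢u  | inj₂ (w , uw , w∈A-u , r)    =
    inj₂ (w , uw , w∈A-u , snoc r xy (x∈p∧x≢y⇒x∈p-y y∈A y≢u))

  -- Reachability inside A is decidable, by recursion on a bound k ≥ ∣A∣: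
  -- a nontrivial walk from u ∈ A is a first step followed by a walk in A - u,
  -- which is strictly smaller.
  walkIn?-bounded : ∀ k A u → u ∈ A → ∣ A ∣ ≤ k → ∀ v → Dec (WalkIn A u v)
  walkIn?-bounded zero A u u∈A ∣A∣≤0 v with <-≤-trans (x∈p⇒∣p-x∣<∣p∣ u∈A) ∣A∣≤0
  ... | ()
  walkIn?-bounded (suc k) A u u∈A ∣A∣≤k v with u ≟ v | any? firstStep?
    where
    firstStep? : ∀ w → Dec (FirstStepVia A u w v)
    firstStep? w with adj G u w Bool.≟ true | w ∈? (A - u)
    ... | no ¬uw | _         = no (λ s → ¬uw (proj₁ s))
    ... | yes _  | no w∉A-u  = no (λ s → w∉A-u (proj₁ (proj₂ s)))
    ... | yes uw | yes w∈A-u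
      with walkIn?-bounded k (A - u) w w∈A-u
             (<⇒≤pred (<-≤-trans (x∈p⇒∣p-x∣<∣p∣ u∈A) ∣A∣≤k)) v
    ...   | yes r = yes (uw , w∈A-u , r)
    ...   | no ¬r = no (λ s → ¬r (proj₂ (proj₂ s)))
  ... | yes refl | _                         = yes nil
  ... | no _     | yes (w , uw , w∈A-u , r) =
    yes (prepend (p─q⊆p A ⁅ u ⁆) uw (p─q⊆p A ⁅ u ⁆ w∈A-u) r)
  ... | no u≢v   | no ¬first                 = no (λ q → [ u≢v , ¬first ] (firstStep q))

  module _ {cmax : ℕ} where

    sameColour? : (col : Coloring n cmax) (u w : Fin n) → Dec (col w ≡ col u)
    sameColour? col u w = col w ≟ col u

    colourClass : Coloring n cmax → Fin n → Subset n
    colourClass col u = subsetOf (sameColour? col u)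

    monoPath⇒walkIn : ∀ {col : Coloring n cmax} {u v} →
                      MonoPath G col u v → WalkIn (colourClass col u) u v
    monoPath⇒walkIn here            = nil
    monoPath⇒walkIn {col} {u} (step q vw w≈u) =
      snoc (monoPath⇒walkIn q) vw (∈-subsetOf⁺ (sameColour? col u) w≈u)

    walkIn⇒monoPath : ∀ {col : Coloring n cmax} {u v} →
                      WalkIn (colourClass col u) u v → MonoPath G col u v
    walkIn⇒monoPath nil             = here
    walkIn⇒monoPath {col} {u} (snoc q vw w∈C) =
      step (walkIn⇒monoPath q) vw (∈-subsetOf⁻ (sameColour? col u) w∈C)

    inComp? : (col : Coloring n cmax) (u v : Fin n) → Dec (InComp G col u v)
    inComp? col u v = map′ walkIn⇒monoPath monoPath⇒walkIn
      (walkIn?-bounded n (colourClass col u) u (∈-subsetOf⁺ (sameColour? col u) refl)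
                       (∣p∣≤n (colourClass col u)) v)

    inComp-colour : ∀ {col : Coloring n cmax} {u v} → InComp G col u v → col v ≡ col u
    inComp-colour here          = refl
    inComp-colour (step _ _ w≈u) = w≈u

    inComp-trans : ∀ {col : Coloring n cmax} {u v w} →
                   InComp G col u v → InComp G col v w → InComp G col u w
    inComp-trans q here            = q
    inComp-trans q (step r xy y≈v) = step (inComp-trans q r) xy (trans y≈v (inComp-colour q))

    inComp-sym : ∀ {col : Coloring n cmax} {u v} → InComp G col u v → InComp G col v u
    inComp-sym here = here
    inComp-sym (step {v = x} {w = y} q xy y≈u) =
      inComp-trans (step here (trans (adj-sym G y x) xy) (trans (inComp-colour q) (sym y≈u)))
                   (inComp-sym q)

    setMove⊆comp : ∀ {col : Coloring n cmax} {p S} → IsSetMove G col p S → p ∈ S →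
                   ∀ v → v ∈ S → InComp G col p v
    setMove⊆comp (inj₁ (u , S≡Comp)) p∈S v v∈S =
      inComp-trans (inComp-sym (proj₁ (S≡Comp _) p∈S)) (proj₁ (S≡Comp v) v∈S)
    setMove⊆comp (inj₂ (_ , S⊆Comp)) _ = S⊆Comp

    recolour : Coloring n cmax → Fin n → Fin cmax → Coloring n cmax
    recolour col u c v with inComp? col u v
    ... | yes _ = c
    ... | no _  = col v

    recolour-in : ∀ col u c {v} → InComp G col u v → recolour col u c v ≡ c
    recolour-in col u c {v} v∈ with inComp? col u v
    ... | yes _ = refl
    ... | no v∉ = ⊥-elim (v∉ v∈)

    recolour-out : ∀ col u c {v} → ¬ InComp G col u v → recolour col u c v ≡ col v
    recolour-out col u c {v} v∉ with inComp? col u v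
    ... | yes v∈ = ⊥-elim (v∉ v∈)
    ... | no _   = refl

    recolour-result : ∀ col u c → MoveResult G col u c (recolour col u c)
    recolour-result col u c v = recolour-in col u c , recolour-out col u c

    -- Recolouring a component keeps it connected, so it only grows.
    recolour-grows : ∀ {col u c v} → InComp G col u v → InComp G (recolour col u c) u v
    recolour-grows here = here
    recolour-grows {col} {u} {c} (step q xy y≈u) =
      step (recolour-grows q) xy
           (trans (recolour-in col u c (step q xy y≈u)) (sym (recolour-in col u c here)))

    module _ (p : Fin n) where

      -- Every Fixed move is the set-move recolouring the whole pivot component.
      fixed⇒sFixed : ∀ {k} {col : Coloring n cmax} → FixedSeq G p k col → SFixedSeq G p k col
      fixed⇒sFixed (done const) = done const
      fixed⇒sFixed {col = col} (move c col' moved rest) =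
        move Comp c col' (inj₁ (p , λ v → ∈-subsetOf⁻ comp? , ∈-subsetOf⁺ comp?))
             (∈-subsetOf⁺ comp? here) setResult (fixed⇒sFixed rest)
        where
        comp? : ∀ v → Dec (InComp G col p v)
        comp? = inComp? col p
        Comp : Subset n
        Comp = subsetOf comp?
        setResult : SetResult G col Comp c col'
        setResult v = (λ v∈ → proj₁ (moved v) (∈-subsetOf⁻ comp? v∈))
                    , (λ v∉ → proj₂ (moved v) (λ v∈ → v∉ (∈-subsetOf⁺ comp? v∈)))

      record Simulates (F S : Coloring n cmax) : Set where
        field
          agree : ∀ v → InComp G F p v ⊎ F v ≡ S v
          pivot : F p ≡ S p
          comp⊆ : ∀ v → InComp G S p v → InComp G F p v

        agree-outside : ∀ {v} → ¬ InComp G F p v → F v ≡ S v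
        agree-outside {v} v∉ = [ (λ v∈ → ⊥-elim (v∉ v∈)) , (λ e → e) ] (agree v)

      open Simulates

      simulates-refl : ∀ col → Simulates col col
      simulates-refl col = record
        { agree = λ _ → inj₂ refl ; pivot = refl ; comp⊆ = λ _ v∈ → v∈ }

      simulates-constant : ∀ {F S} → Simulates F S → IsConstant G S → IsConstant G F
      simulates-constant sim (c , S≡c) = c , λ v →
        [ (λ v∈ → trans (inComp-colour v∈) (trans (pivot sim) (S≡c p)))
        , (λ e → trans e (S≡c v)) ] (agree sim v)

      -- Answering the set-move (T , c) with the Fixed move (p , c) preserves the
      -- invariant: vertices of T lie in Comp(S,p) ⊆ Comp(F,p), which is recoloured.
      simulates-step : ∀ {F S S' T c} → Simulates F S → IsSetMove G S p T → p ∈ T →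
                       SetResult G S T c S' → Simulates (recolour F p c) S'
      simulates-step {F = F} {S' = S'} {c = c} sim setMove p∈T result = record
        { agree = agree'
        ; pivot = trans (recolour-in F p c here) (sym (proj₁ (result p) p∈T))
        ; comp⊆ = comp⊆'
        }
        where
        F' : Coloring n cmax
        F' = recolour F p c

        -- Outside Comp(F,p) ⊇ T the move changes neither F nor S, so F' agrees with S'.
        unchanged : ∀ {v} → ¬ InComp G F p v → F' v ≡ S' v
        unchanged {v} v∉ =
          trans (recolour-out F p c v∉)
            (trans (agree-outside sim v∉)
              (sym (proj₂ (result v) (λ v∈T → v∉ (comp⊆ sim v (setMove⊆comp setMove p∈T v v∈T))))))

        agree' : ∀ v → InComp G F' p v ⊎ F' v ≡ S' v
        agree' v = byMembership (inComp? F p v)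
          where
          byMembership : Dec (InComp G F p v) → InComp G F' p v ⊎ F' v ≡ S' v
          byMembership (yes v∈) = inj₁ (recolour-grows v∈)
          byMembership (no v∉)  = inj₂ (unchanged v∉)

        comp⊆' : ∀ v → InComp G S' p v → InComp G F' p v
        comp⊆' v here = here
        comp⊆' w (step {v = x} q xw w≈p) = byMembership (inComp? F p w)
          where
          -- Outside Comp(F,p): F' w ≡ S' w ≡ S' p ≡ c ≡ F' p, extending the walk.
          byMembership : Dec (InComp G F p w) → InComp G F' p w
          byMembership (yes w∈) = recolour-grows w∈
          byMembership (no w∉)  = step (comp⊆' x q) xw
            (trans (unchanged w∉) (trans w≈p (trans (proj₁ (result p) p∈T)
              (sym (recolour-in F p c here)))))

      sFixed⇒fixed : ∀ {k} {F S : Coloring n cmax} → Simulates F S →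
                     SFixedSeq G p k S → FixedSeq G p k F
      sFixed⇒fixed sim (done const) = done (simulates-constant sim const)
      sFixed⇒fixed {F = F} sim (move T c S' setMove p∈T result rest) =
        move c (recolour F p c) (recolour-result F p c)
             (sFixed⇒fixed (simulates-step sim setMove p∈T result) rest)

lemma19 : ∀ {n cmax : ℕ} (G : Graph n) (col : Coloring n cmax) (p : Fin n) →
    (k : ℕ) → (OptFixed≤ G col p k → OptSFixed≤ G col p k)
    × (OptSFixed≤ G col p k → OptFixed≤ G col p k)
lemma19 G col p k =
    (λ { (m , m≤k , seq) → m , m≤k , fixed⇒sFixed G p seq })
  , (λ { (m , m≤k , seq) → m , m≤k , sFixed⇒fixed G p (simulates-refl G p col) seq })
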